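{- If $G$ is an outerplanar map, then the comparability graph of the vertex-face incidence poset of $G$ is a SegRay graph.
   Context: An outerplanar map is a graph together with a fixed plane embedding in which all vertices lie on the outer face. The vertex-face incidence poset of a plane graph has as elements its vertices and its faces, with $v<f$ iff vertex $v$ is incident to face $f$. A SegRay graph is the intersection graph of a finite family of horizontal segments and vertical rays all pointing in the same direction, in general position so that no two segments and no two rays intersect (segment and ray adjacent iff they intersect). -}

module Defs where

open import Data.Bool using (Bool; true; false)
open import Data.Nat as ℕ using (ℕ)
open import Data.Fin using (Fin) renaming (_<_ to _<ᶠ_; _≤_ to _≤ᶠ_)
open import Data.Fin.Subset using (Subset; _∈_; ∣_∣)
open import Data.Rational using (ℚ) renaming (_≤_ to _≤ℚ_; _<_ to _<ℚ_)
open import Data.Product using (Σ; _×_)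
open import Data.Sum using (_⊎_; inj₁; inj₂)
open import Data.Unit using (⊤; tt)
open import Data.Empty using (⊥)
open import Function.Bundles using (_⇔_)
open import Relation.Nullary using (¬_)
open import Relation.Binary.PropositionalEquality using (_≡_; _≢_)

-- An outerplanar map on n vertices is encoded by its vertex set Fin n,
-- numbered 0,1,…,n-1 in the cyclic order in which the vertices appear
-- along the outer face (every vertex lies on the outer face), together
-- with a simple graph whose edges are pairwise non-crossing chords with
-- respect to this cyclic order (equivalently: the straight-line drawing
-- with the vertices in convex position in this order).

record OuterplanarMap : Set where
  field
    n         : ℕ
    adj       : Fin n → Fin n → Bool
    adj-sym   : ∀ i j → adj i j ≡ adj j i
    adj-irrefl : ∀ i → adj i i ≡ false
    noncrossing : ∀ a b c d → a <ᶠ c → c <ᶠ b → b <ᶠ d →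
                  adj a b ≡ true → adj c d ≡ false

module _ (G : OuterplanarMap) where
  open OuterplanarMap G

  Edge : Fin n → Fin n → Set
  Edge i j = adj i j ≡ true

  -- i < j are consecutive members of S in the cyclic order of S
  Consecutive : Subset n → Fin n → Fin n → Set
  Consecutive S i j =
      (∀ k → k ∈ S → ¬ (i <ᶠ k × k <ᶠ j))
    ⊎ (∀ k → k ∈ S → (i ≤ᶠ k × k ≤ᶠ j))         -- i = min S, j = max S (wrap-around)

  -- S is the vertex set of a bounded (inner) face: a polygon whose sides
  -- are edges of G and which contains no diagonal edge of G.
  InnerFace : Subset n → Set
  InnerFace S = (3 ℕ.≤ ∣ S ∣) ×
    (∀ i j → i ∈ S → j ∈ S → i <ᶠ j → (Edge i j ⇔ Consecutive S i j))

  -- Elements of the vertex-face incidence poset: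
  --   inj₁ v            : vertex v
  --   inj₂ (inj₁ tt)    : the outer face
  --   inj₂ (inj₂ S)     : the inner face with vertex set S (when InnerFace S)
  Elem : Set
  Elem = Fin n ⊎ (⊤ ⊎ Subset n)

  IsElem : Elem → Set
  IsElem (inj₁ v)         = ⊤
  IsElem (inj₂ (inj₁ _))  = ⊤
  IsElem (inj₂ (inj₂ S))  = InnerFace S

  _≺_ : Elem → Elem → Set
  inj₁ v ≺ inj₂ (inj₁ _) = ⊤          -- every vertex is on the outer face
  inj₁ v ≺ inj₂ (inj₂ S) = v ∈ S
  _ ≺ _ = ⊥

  Comparable : Elem → Elem → Set
  Comparable x y = (x ≺ y) ⊎ (y ≺ x)

data Dir : Set where
  up down : Dir

data Shape : Set where
  seg : (y a b : ℚ) → Shape     -- horizontal segment {(t , y) | a ≤ t ≤ b}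
  ray : (x c : ℚ) → Shape       -- vertical ray from (x , c), direction given by Dir

WellFormed : Shape → Set
WellFormed (seg y a b) = a <ℚ b
WellFormed (ray x c)   = ⊤

Beyond : Dir → ℚ → ℚ → Set      -- height y is on the ray starting at height c
Beyond up   c y = c ≤ℚ y
Beyond down c y = y ≤ℚ c

Meets : Dir → Shape → Shape → Set
Meets d (seg y a b) (seg y' a' b') = y ≡ y' × a ≤ℚ b' × a' ≤ℚ b
Meets d (ray x c)   (ray x' c')    = x ≡ x'
Meets d (seg y a b) (ray x c)      = a ≤ℚ x × x ≤ℚ b × Beyond d c y
Meets d (ray x c)   (seg y a b)    = a ≤ℚ x × x ≤ℚ b × Beyond d c y

SameKind : Shape → Shape → Set
SameKind (seg _ _ _) (seg _ _ _) = ⊤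
SameKind (ray _ _)   (ray _ _)   = ⊤
SameKind _ _ = ⊥

IsSegRay : (X : Set) → (X → Set) → (X → X → Set) → Set
IsSegRay X V Adj = Σ Dir λ d → Σ (X → Shape) λ f →
    (∀ x → V x → WellFormed (f x))
  × (∀ x y → V x → V y → x ≢ y → SameKind (f x) (f y) → ¬ Meets d (f x) (f y))
  × (∀ x y → V x → V y → x ≢ y → (Adj x y ⇔ Meets d (f x) (f y)))

-- Number the vertices 0, …, n-1 along the outer face. Vertex v becomes the downward ray at
-- abscissa v, an inner face T the horizontal segment over [min T, max T], and the outer face
-- a segment at height 0 below everything. Let ℓ(v) (innermost v below) be the length b - a of
-- the shortest chord ab with a < v < b. A face containing v lies within every chord over v
-- (otherwise the chord would cross a side of the face or be a diagonal of it), so its span is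
-- at most ℓ(v). Conversely, if min T ≤ v ≤ max T but v ∉ T, the side of T passing over v is a
-- chord over v shorter than the span of T. So if faces are stacked by span and the ray of v
-- starts just above the faces of span ℓ(v), it meets exactly the faces at v; faces of equal
-- span are separated by the binary code of their vertex sets.

module Submission where

open import Defs
open import Data.Bool using (true; false)
import Data.Bool as Bool
open import Data.Bool.Properties using (not-¬)
open import Data.Empty using (⊥-elim)
open import Data.Fin using (Fin; toℕ; _<_; _≤_)
import Data.Fin.Properties as Fin
open import Data.Fin.Subset using (Subset; Nonempty; _∈_; _∉_; _⊆_; _∪_; ⁅_⁆; ∣_∣)
open import Data.Fin.Subset.Properties
  using (_∈?_; p⊆q⇒∣p∣≤∣q∣; ∣⁅x⁆∣≡1; x∈⁅x⁆; x∈p∪q⁺)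
open import Data.Integer as ℤ using (+_)
import Data.Integer.Properties as ℤ
open import Data.Nat as ℕ using (ℕ; zero; suc; _+_; _*_; _∸_; _^_; _%_; z≤n; s≤s; s≤s⁻¹; NonZero)
open import Data.Nat.DivMod using ([m+kn]%n≡m%n; m<n⇒m%n≡m)
open import Data.Nat.Properties
open import Data.Product using (∃; ∃₂; _×_; _,_; proj₁; proj₂)
open import Data.Rational as ℚ using (ℚ; *≤*; *<*)
open import Data.Rational.Literals using (fromℤ)
open import Data.Sum using (_⊎_; inj₁; inj₂; [_,_])
open import Data.Unit using (tt)
open import Data.Vec using (_∷_; []; here; there)
open import Function using (_∘_; id)
open import Function.Bundles using (_⇔_; mk⇔; Equivalence)
open import Relation.Binary.Definitions using (tri<; tri≈; tri>)
open import Relation.Binary.PropositionalEquality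
  using (_≡_; _≢_; refl; sym; trans; cong; cong₂; subst; subst₂; module ≡-Reasoning)
open import Relation.Nullary using (¬_; ¬?; yes; no; contradiction)
open import Relation.Nullary.Decidable using (_×-dec_)
open import Relation.Unary using (Pred; Decidable)


toℚ : ℕ → ℚ
toℚ n = fromℤ (+ n)

toℚ-mono-≤ : ∀ {m n} → m ℕ.≤ n → toℚ m ℚ.≤ toℚ n
toℚ-mono-≤ {m} {n} m≤n =
  *≤* (subst₂ ℤ._≤_ (sym (ℤ.*-identityʳ (+ m))) (sym (ℤ.*-identityʳ (+ n))) (ℤ.+≤+ m≤n))

toℚ-mono-< : ∀ {m n} → m ℕ.< n → toℚ m ℚ.< toℚ n
toℚ-mono-< {m} {n} m<n =
  *<* (subst₂ ℤ._<_ (sym (ℤ.*-identityʳ (+ m))) (sym (ℤ.*-identityʳ (+ n))) (ℤ.+<+ m<n))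

toℚ-cancel-≤ : ∀ {m n} → toℚ m ℚ.≤ toℚ n → m ℕ.≤ n
toℚ-cancel-≤ {m} {n} (*≤* p) =
  ℤ.drop‿+≤+ (subst₂ ℤ._≤_ (ℤ.*-identityʳ (+ m)) (ℤ.*-identityʳ (+ n)) p)

toℚ-injective : ∀ {m n} → toℚ m ≡ toℚ n → m ≡ n
toℚ-injective eq = ℤ.+-injective (cong ℚ.ℚ.numerator eq)

m+n*k<o*k⇔n<o : ∀ {m k} n o → m ℕ.< k → (m + n * k ℕ.< o * k ⇔ n ℕ.< o)
m+n*k<o*k⇔n<o {m} {k} n o m<k = mk⇔ to from
  where
  to : m + n * k ℕ.< o * k → n ℕ.< o
  to lt = ≰⇒> λ o≤n → <⇒≱ lt (≤-trans (*-monoˡ-≤ k o≤n) (m≤n+m (n * k) m))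
  from : n ℕ.< o → m + n * k ℕ.< o * k
  from n<o = <-≤-trans (+-monoˡ-< (n * k) m<k) (*-monoˡ-≤ k n<o)

[m+n*k]%k≡m : ∀ {m k} n .{{_ : NonZero k}} → m ℕ.< k → (m + n * k) % k ≡ m
[m+n*k]%k≡m {m} {k} n m<k = trans ([m+kn]%n≡m%n m n k) (m<n⇒m%n≡m m<k)

∸<∸ : ∀ {lo a b hi} → lo ℕ.≤ a → a ℕ.≤ b → b ℕ.≤ hi → lo ℕ.< a ⊎ b ℕ.< hi →
      b ∸ a ℕ.< hi ∸ lo
∸<∸ {lo} lo≤a a≤b b≤hi (inj₁ lo<a) = ≤-trans (∸-monoʳ-< lo<a a≤b) (∸-monoˡ-≤ lo b≤hi)
∸<∸ {hi = hi} lo≤a a≤b b≤hi (inj₂ b<hi) = ≤-trans (∸-monoˡ-< b<hi a≤b) (∸-monoʳ-≤ hi lo≤a)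


Least : ∀ {n} → Pred (Fin n) _ → Set
Least P = (∃ λ k → P k × (∀ j → P j → k ≤ j)) ⊎ (∀ j → ¬ P j)

Greatest : ∀ {n} → Pred (Fin n) _ → Set
Greatest P = (∃ λ k → P k × (∀ j → P j → j ≤ k)) ⊎ (∀ j → ¬ P j)

least : ∀ {n} {P : Pred (Fin n) _} → Decidable P → Least P
least {zero} P? = inj₂ λ ()
least {suc n} P? with P? Fin.zero | least (λ k → P? (Fin.suc k))
... | yes p | _ = inj₁ (Fin.zero , p , λ _ _ → z≤n)
... | no ¬p | inj₁ (k , pk , min) =
  inj₁ (Fin.suc k , pk , λ { Fin.zero p → contradiction p ¬p ; (Fin.suc j) pj → s≤s (min j pj) })
... | no ¬p | inj₂ none = inj₂ λ { Fin.zero → ¬p ; (Fin.suc j) → none j }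

greatest : ∀ {n} {P : Pred (Fin n) _} → Decidable P → Greatest P
greatest {zero} P? = inj₂ λ ()
greatest {suc n} P? with greatest (λ k → P? (Fin.suc k)) | P? Fin.zero
... | inj₁ (k , pk , max) | _ =
  inj₁ (Fin.suc k , pk , λ { Fin.zero _ → z≤n ; (Fin.suc j) pj → s≤s (max j pj) })
... | inj₂ none | yes p = inj₁ (Fin.zero , p , λ { Fin.zero _ → z≤n ; (Fin.suc j) pj → contradiction pj (none j) })
... | inj₂ none | no ¬p = inj₂ λ { Fin.zero → ¬p ; (Fin.suc j) → none j }


∣p∪q∣≤∣p∣+∣q∣ : ∀ {n} (p q : Subset n) → ∣ p ∪ q ∣ ℕ.≤ ∣ p ∣ + ∣ q ∣
∣p∪q∣≤∣p∣+∣q∣ [] [] = z≤n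
∣p∪q∣≤∣p∣+∣q∣ (true ∷ p) (true ∷ q) =
  s≤s (≤-trans (∣p∪q∣≤∣p∣+∣q∣ p q) (≤-trans (n≤1+n _) (≤-reflexive (sym (+-suc ∣ p ∣ ∣ q ∣)))))
∣p∪q∣≤∣p∣+∣q∣ (true ∷ p) (false ∷ q) = s≤s (∣p∪q∣≤∣p∣+∣q∣ p q)
∣p∪q∣≤∣p∣+∣q∣ (false ∷ p) (true ∷ q) =
  ≤-trans (s≤s (∣p∪q∣≤∣p∣+∣q∣ p q)) (≤-reflexive (sym (+-suc ∣ p ∣ ∣ q ∣)))
∣p∪q∣≤∣p∣+∣q∣ (false ∷ p) (false ∷ q) = ∣p∪q∣≤∣p∣+∣q∣ p q

0<∣p∣⇒Nonempty : ∀ {n} (p : Subset n) → 0 ℕ.< ∣ p ∣ → Nonempty p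
0<∣p∣⇒Nonempty (true ∷ p) _ = Fin.zero , here
0<∣p∣⇒Nonempty (false ∷ p) 0<∣p∣ with 0<∣p∣⇒Nonempty p 0<∣p∣
... | k , k∈p = Fin.suc k , there k∈p

2<∣p∣⇒∃∈≢₂ : ∀ {n} (p : Subset n) → 2 ℕ.< ∣ p ∣ → (a b : Fin n) →
             ∃ λ k → k ∈ p × k ≢ a × k ≢ b
2<∣p∣⇒∃∈≢₂ p 2<∣p∣ a b with Fin.any? (λ k → (k ∈? p) ×-dec ¬? (k Fin.≟ a) ×-dec ¬? (k Fin.≟ b))
... | yes found = found
... | no none = contradiction ∣p∣≤2 (<⇒≱ 2<∣p∣)
  where
  p⊆ab : p ⊆ ⁅ a ⁆ ∪ ⁅ b ⁆
  p⊆ab {k} k∈p with k Fin.≟ a | k Fin.≟ b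
  ... | yes refl | _ = x∈p∪q⁺ (inj₁ (x∈⁅x⁆ k))
  ... | no _ | yes refl = x∈p∪q⁺ (inj₂ (x∈⁅x⁆ k))
  ... | no k≢a | no k≢b = contradiction (k , k∈p , k≢a , k≢b) none
  ∣p∣≤2 : ∣ p ∣ ℕ.≤ 2
  ∣p∣≤2 = ≤-trans (p⊆q⇒∣p∣≤∣q∣ p⊆ab)
    (≤-trans (∣p∪q∣≤∣p∣+∣q∣ ⁅ a ⁆ ⁅ b ⁆) (≤-reflexive (cong₂ _+_ (∣⁅x⁆∣≡1 a) (∣⁅x⁆∣≡1 b))))

code : ∀ {n} → Subset n → ℕ
code [] = 0
code (false ∷ p) = code p
code {suc n} (true ∷ p) = 2 ^ n + code p

code< : ∀ {n} (p : Subset n) → code p ℕ.< 2 ^ n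
code< [] = s≤s z≤n
code< {suc n} (false ∷ p) = ≤-trans (code< p) (m≤m+n (2 ^ n) _)
code< {suc n} (true ∷ p) = +-monoʳ-< (2 ^ n) (≤-trans (code< p) (m≤m+n (2 ^ n) 0))

code-injective : ∀ {n} (p q : Subset n) → code p ≡ code q → p ≡ q
code-injective [] [] _ = refl
code-injective (false ∷ p) (false ∷ q) eq = cong (false ∷_) (code-injective p q eq)
code-injective {suc n} (true ∷ p) (true ∷ q) eq =
  cong (true ∷_) (code-injective p q (+-cancelˡ-≡ (2 ^ n) _ _ eq))
code-injective {suc n} (false ∷ p) (true ∷ q) eq =
  contradiction (≤-trans (m≤m+n (2 ^ n) _) (≤-reflexive (sym eq))) (<⇒≱ (code< p))
code-injective {suc n} (true ∷ p) (false ∷ q) eq =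
  contradiction (≤-trans (m≤m+n (2 ^ n) _) (≤-reflexive eq)) (<⇒≱ (code< q))

-- 0 on the empty subset.
lo hi len : ∀ {n} → Subset n → ℕ
lo p with least (_∈? p)
... | inj₁ (k , _) = toℕ k
... | inj₂ _ = 0
hi p with greatest (_∈? p)
... | inj₁ (k , _) = toℕ k
... | inj₂ _ = 0
len p = hi p ∸ lo p

module _ {n} (p : Subset n) where

  lo≤ : ∀ {k} → k ∈ p → lo p ℕ.≤ toℕ k
  lo≤ {k} k∈p with least (_∈? p)
  ... | inj₁ (_ , _ , min) = min k k∈p
  ... | inj₂ none = contradiction k∈p (none k)

  lo-attained : ∀ {k} → k ∈ p → ∃ λ j → j ∈ p × lo p ≡ toℕ j
  lo-attained {k} k∈p with least (_∈? p)
  ... | inj₁ (j , j∈p , _) = j , j∈p , refl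
  ... | inj₂ none = contradiction k∈p (none k)

  ≤hi : ∀ {k} → k ∈ p → toℕ k ℕ.≤ hi p
  ≤hi {k} k∈p with greatest (_∈? p)
  ... | inj₁ (_ , _ , max) = max k k∈p
  ... | inj₂ none = contradiction k∈p (none k)

  hi-attained : ∀ {k} → k ∈ p → ∃ λ j → j ∈ p × hi p ≡ toℕ j
  hi-attained {k} k∈p with greatest (_∈? p)
  ... | inj₁ (j , j∈p , _) = j , j∈p , refl
  ... | inj₂ none = contradiction k∈p (none k)

  hi<n : ∀ {k} → k ∈ p → hi p ℕ.< n
  hi<n k∈p with hi-attained k∈p
  ... | j , _ , hi≡j = subst (ℕ._< n) (sym hi≡j) (Fin.toℕ<n j)

  member-below : ∀ {k v} → k ∈ p → v ∉ p → lo p ℕ.≤ toℕ v → ∃ λ j → j ∈ p × j < v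
  member-below {v = v} k∈p v∉p lo≤v with lo-attained k∈p
  ... | j , j∈p , lo≡j = j , j∈p , Fin.≤∧≢⇒< (subst (ℕ._≤ toℕ v) lo≡j lo≤v) λ { refl → v∉p j∈p }

  member-above : ∀ {k v} → k ∈ p → v ∉ p → toℕ v ℕ.≤ hi p → ∃ λ j → j ∈ p × v < j
  member-above {v = v} k∈p v∉p v≤hi with hi-attained k∈p
  ... | j , j∈p , hi≡j = j , j∈p , Fin.≤∧≢⇒< (subst (toℕ v ℕ.≤_) hi≡j v≤hi) λ { refl → v∉p j∈p }

  lo<hi : ∀ {j k : Fin n} → j ∈ p → k ∈ p → j < k → lo p ℕ.< hi p
  lo<hi j∈p k∈p j<k = ≤-<-trans (lo≤ j∈p) (<-≤-trans j<k (≤hi k∈p))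

  len≤∸ : ∀ {a b : Fin n} {k} → k ∈ p → (∀ j → j ∈ p → a ≤ j × j ≤ b) → len p ℕ.≤ toℕ b ∸ toℕ a
  len≤∸ {a} {b} k∈p bounded with lo-attained k∈p | hi-attained k∈p
  ... | j , j∈p , lo≡j | j′ , j′∈p , hi≡j′ =
    ∸-mono (subst (ℕ._≤ toℕ b) (sym hi≡j′) (proj₂ (bounded j′ j′∈p)))
           (subst (toℕ a ℕ.≤_) (sym lo≡j) (proj₁ (bounded j j∈p)))

  ∸<len : ∀ {a b k : Fin n} → a ∈ p → b ∈ p → a ≤ b → k ∈ p → k < a ⊎ b < k →
          toℕ b ∸ toℕ a ℕ.< len p
  ∸<len a∈p b∈p a≤b k∈p (inj₁ k<a) = ∸<∸ (lo≤ a∈p) a≤b (≤hi b∈p) (inj₁ (≤-<-trans (lo≤ k∈p) k<a))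
  ∸<len a∈p b∈p a≤b k∈p (inj₂ b<k) = ∸<∸ (lo≤ a∈p) a≤b (≤hi b∈p) (inj₂ (<-≤-trans b<k (≤hi k∈p)))

2<∣p∣⇒lo<hi : ∀ {n} (p : Subset n) → 2 ℕ.< ∣ p ∣ → lo p ℕ.< hi p
2<∣p∣⇒lo<hi p 2<∣p∣ with 0<∣p∣⇒Nonempty p (≤-trans (s≤s z≤n) 2<∣p∣)
... | j , j∈p with 2<∣p∣⇒∃∈≢₂ p 2<∣p∣ j j
... | k , k∈p , k≢j , _ with Fin.<-cmp j k
...   | tri< j<k _ _ = lo<hi p j∈p k∈p j<k
...   | tri≈ _ j≡k _ = contradiction (sym j≡k) k≢j
...   | tri> _ _ k<j = lo<hi p k∈p j∈p k<j

gap<len : ∀ {n} (p : Subset n) → 2 ℕ.< ∣ p ∣ → ∀ {a b} → a ∈ p → b ∈ p → a < b →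
          (∀ j → j ∈ p → ¬ (a < j × j < b)) → toℕ b ∸ toℕ a ℕ.< len p
gap<len p 2<∣p∣ {a} {b} a∈p b∈p a<b gap with 2<∣p∣⇒∃∈≢₂ p 2<∣p∣ a b
... | j , j∈p , j≢a , j≢b with Fin.<-cmp j a | Fin.<-cmp b j
...   | tri< j<a _ _ | _ = ∸<len p a∈p b∈p (<⇒≤ a<b) j∈p (inj₁ j<a)
...   | _ | tri< b<j _ _ = ∸<len p a∈p b∈p (<⇒≤ a<b) j∈p (inj₂ b<j)
...   | tri≈ _ j≡a _ | _ = contradiction j≡a j≢a
...   | _ | tri≈ _ b≡j _ = contradiction (sym b≡j) j≢b
...   | tri> _ _ a<j | tri> _ _ j<b = contradiction (a<j , j<b) (gap j j∈p)


module Faces (G : OuterplanarMap) where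
  open OuterplanarMap G

  private
    variable
      a b r s u v w x : Fin n
      T : Subset n

  edge-sym : Edge G a b → Edge G b a
  edge-sym {a} {b} e = trans (adj-sym b a) e

  edges-do-not-cross : Edge G a b → a < r → r < b → s < a ⊎ b < s → ¬ Edge G r s
  edges-do-not-cross eab a<r r<b (inj₁ s<a) ers = not-¬ eab (noncrossing _ _ _ _ s<a a<r r<b (edge-sym ers))
  edges-do-not-cross eab a<r r<b (inj₂ b<s) ers = not-¬ ers (noncrossing _ _ _ _ a<r r<b b<s eab)

  side : InnerFace G T → a ∈ T → b ∈ T → a < b → Consecutive G T a b → Edge G a b
  side face a∈T b∈T a<b = Equivalence.from (proj₂ face _ _ a∈T b∈T a<b)

  -- The side of T leaving r towards smaller indices; it wraps around (second case) when r is
  -- the least vertex of T.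
  lower-side : InnerFace G T → r ∈ T → (∀ k → k ∈ T → x < k → r ≤ k) →
               ∃ λ s → s ∈ T × Edge G r s × (s ≤ x ⊎ (∀ k → k ∈ T → r ≤ k × k ≤ s))
  lower-side {T} {r} {x} face r∈T r-least with greatest (λ k → (k ∈? T) ×-dec (k Fin.<? r))
  ... | inj₁ (s , (s∈T , s<r) , s-max) =
    s , s∈T , edge-sym (side face s∈T r∈T s<r (inj₁ gap)) , inj₁ (≮⇒≥ λ x<s → <⇒≱ s<r (r-least s s∈T x<s))
    where
    gap : ∀ k → k ∈ T → ¬ (s < k × k < r)
    gap k k∈T (s<k , k<r) = <⇒≱ s<k (s-max k (k∈T , k<r))
  ... | inj₂ none-below with greatest (_∈? T) | 2<∣p∣⇒∃∈≢₂ T (proj₁ face) r r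
  ... | inj₂ empty | _ = contradiction r∈T (empty r)
  ... | inj₁ (s , s∈T , s-max) | k , k∈T , k≢r , _ =
    s , s∈T , side face r∈T s∈T r<s (inj₂ span) , inj₂ span
    where
    span : ∀ j → j ∈ T → r ≤ j × j ≤ s
    span j j∈T = ≮⇒≥ (λ j<r → none-below j (j∈T , j<r)) , s-max j j∈T
    r<s : r < s
    r<s = <-≤-trans (Fin.≤∧≢⇒< (proj₁ (span k k∈T)) (k≢r ∘ sym)) (s-max k k∈T)

  upper-side : InnerFace G T → r ∈ T → (∀ k → k ∈ T → k < x → k ≤ r) →
               ∃ λ s → s ∈ T × Edge G r s × (x ≤ s ⊎ (∀ k → k ∈ T → s ≤ k × k ≤ r))
  upper-side {T} {r} {x} face r∈T r-greatest with least (λ k → (k ∈? T) ×-dec (r Fin.<? k))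
  ... | inj₁ (s , (s∈T , r<s) , s-min) =
    s , s∈T , side face r∈T s∈T r<s (inj₁ gap) , inj₁ (≮⇒≥ λ s<x → <⇒≱ r<s (r-greatest s s∈T s<x))
    where
    gap : ∀ k → k ∈ T → ¬ (r < k × k < s)
    gap k k∈T (r<k , k<s) = <⇒≱ k<s (s-min k (k∈T , r<k))
  ... | inj₂ none-above with least (_∈? T) | 2<∣p∣⇒∃∈≢₂ T (proj₁ face) r r
  ... | inj₂ empty | _ = contradiction r∈T (empty r)
  ... | inj₁ (s , s∈T , s-min) | k , k∈T , k≢r , _ =
    s , s∈T , edge-sym (side face s∈T r∈T s<r (inj₂ span)) , inj₂ span
    where
    span : ∀ j → j ∈ T → s ≤ j × j ≤ r
    span j j∈T = s-min j j∈T , ≮⇒≥ (λ r<j → none-above j (j∈T , r<j))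
    s<r : s < r
    s<r = ≤-<-trans (s-min k k∈T) (Fin.≤∧≢⇒< (proj₂ (span k k∈T)) k≢r)

  ChordOver : Fin n → Fin n → Fin n → Set
  ChordOver v a b = Edge G a b × a < v × v < b

  -- Otherwise the lower side of the first vertex of T after a would cross the chord.
  left-end∈ : InnerFace G T → ChordOver u a b → u ∈ T → w ∈ T → w < a ⊎ b < w → a ∈ T
  left-end∈ {T} {u} {a} {b} {w} face (eab , a<u , u<b) u∈T w∈T w-outside with a ∈? T
  ... | yes a∈T = a∈T
  ... | no a∉T with least (λ k → (k ∈? T) ×-dec (a Fin.<? k))
  ... | inj₂ none = contradiction (u∈T , a<u) (none u)
  ... | inj₁ (r , (r∈T , a<r) , r-min) with lower-side face r∈T (λ k k∈T a<k → r-min k (k∈T , a<k))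
  ... | s , s∈T , ers , s-position = contradiction ers (edges-do-not-cross eab a<r r<b s-outside)
    where
    r<b : r < b
    r<b = ≤-<-trans (r-min u (u∈T , a<u)) u<b
    w-above-r : r ≤ w → b < w
    w-above-r r≤w = [ (λ w<a → contradiction (<-trans a<r (≤-<-trans r≤w w<a)) (<-irrefl refl)) , id ] w-outside
    s-outside : s < a ⊎ b < s
    s-outside = [ (λ s≤a → inj₁ (Fin.≤∧≢⇒< s≤a λ { refl → a∉T s∈T }))
                , (λ span → inj₂ (<-≤-trans (w-above-r (proj₁ (span w w∈T))) (proj₂ (span w w∈T)))) ] s-position

  right-end∈ : InnerFace G T → ChordOver u a b → u ∈ T → w ∈ T → w < a ⊎ b < w → b ∈ T
  right-end∈ {T} {u} {a} {b} {w} face (eab , a<u , u<b) u∈T w∈T w-outside with b ∈? T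
  ... | yes b∈T = b∈T
  ... | no b∉T with greatest (λ k → (k ∈? T) ×-dec (k Fin.<? b))
  ... | inj₂ none = contradiction (u∈T , u<b) (none u)
  ... | inj₁ (r , (r∈T , r<b) , r-max) with upper-side face r∈T (λ k k∈T k<b → r-max k (k∈T , k<b))
  ... | s , s∈T , ers , s-position = contradiction ers (edges-do-not-cross eab a<r r<b s-outside)
    where
    a<r : a < r
    a<r = <-≤-trans a<u (r-max u (u∈T , u<b))
    w-below-r : w ≤ r → w < a
    w-below-r w≤r = [ id , (λ b<w → contradiction (<-trans r<b (<-≤-trans b<w w≤r)) (<-irrefl refl)) ] w-outside
    s-outside : s < a ⊎ b < s
    s-outside = [ (λ b≤s → inj₂ (Fin.≤∧≢⇒< b≤s λ { refl → b∉T s∈T }))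
                , (λ span → inj₁ (≤-<-trans (proj₁ (span w w∈T)) (w-below-r (proj₂ (span w w∈T))))) ] s-position

  -- By left-end∈ and right-end∈ the chord would be a diagonal of T.
  face-not-across-chord : InnerFace G T → ChordOver u a b → u ∈ T → w ∈ T → ¬ (w < a ⊎ b < w)
  face-not-across-chord {T} {u} {a} {b} {w} face chord@(eab , a<u , u<b) u∈T w∈T w-outside =
    not-consecutive (Equivalence.to (proj₂ face a b a∈T b∈T (<-trans a<u u<b)) eab)
    where
    a∈T = left-end∈ face chord u∈T w∈T w-outside
    b∈T = right-end∈ face chord u∈T w∈T w-outside
    not-consecutive : ¬ Consecutive G T a b
    not-consecutive (inj₁ gap) = gap u u∈T (a<u , u<b)
    not-consecutive (inj₂ span) =
      [ (λ w<a → <⇒≱ w<a (proj₁ (span w w∈T))) , (λ b<w → <⇒≱ b<w (proj₂ (span w w∈T))) ] w-outside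

  face-within-chord : InnerFace G T → ChordOver u a b → u ∈ T → ∀ w → w ∈ T → a ≤ w × w ≤ b
  face-within-chord face chord u∈T w w∈T =
    ≮⇒≥ (face-not-across-chord face chord u∈T w∈T ∘ inj₁) ,
    ≮⇒≥ (face-not-across-chord face chord u∈T w∈T ∘ inj₂)

  ShortChordOver : Fin n → Pred (Fin (suc n)) _
  ShortChordOver v ℓ = ∃₂ λ a b → ChordOver v a b × toℕ b ∸ toℕ a ℕ.≤ toℕ ℓ

  shortChordOver? : ∀ v → Decidable (ShortChordOver v)
  shortChordOver? v ℓ = Fin.any? λ a → Fin.any? λ b →
    ((adj a b Bool.≟ true) ×-dec (a Fin.<? v) ×-dec (v Fin.<? b)) ×-dec (toℕ b ∸ toℕ a ℕ.≤? toℕ ℓ)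

  innermost : Fin n → ℕ
  innermost v with least (shortChordOver? v)
  ... | inj₁ (ℓ , _) = toℕ ℓ
  ... | inj₂ _ = n

  innermost-minimal : ∀ {v ℓ} → ShortChordOver v ℓ → innermost v ℕ.≤ toℕ ℓ
  innermost-minimal {v} {ℓ} short with least (shortChordOver? v)
  ... | inj₁ (_ , _ , min) = min ℓ short
  ... | inj₂ none = contradiction short (none ℓ)

  innermost≤ : ChordOver v a b → innermost v ℕ.≤ toℕ b ∸ toℕ a
  innermost≤ {v} {a} {b} chord =
    subst (innermost v ℕ.≤_) (Fin.toℕ-fromℕ< b∸a<1+n)
      (innermost-minimal (a , b , chord , ≤-reflexive (sym (Fin.toℕ-fromℕ< b∸a<1+n))))
    where
    b∸a<1+n : toℕ b ∸ toℕ a ℕ.< suc n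
    b∸a<1+n = s≤s (≤-trans (m∸n≤m (toℕ b) (toℕ a)) (<⇒≤ (Fin.toℕ<n b)))

  innermost-attained : ∀ v → (∃₂ λ a b → ChordOver v a b × toℕ b ∸ toℕ a ℕ.≤ innermost v) ⊎ innermost v ≡ n
  innermost-attained v with least (shortChordOver? v)
  ... | inj₁ (_ , short , _) = inj₁ short
  ... | inj₂ _ = inj₂ refl

  len≤innermost : InnerFace G T → v ∈ T → len T ℕ.≤ innermost v
  len≤innermost {T} {v} face v∈T with innermost-attained v
  ... | inj₁ (a , b , chord , short) = ≤-trans (len≤∸ T v∈T (face-within-chord face chord v∈T)) short
  ... | inj₂ innermost≡n = ≤-trans (m∸n≤m (hi T) (lo T)) (subst (hi T ℕ.≤_) (sym innermost≡n) (<⇒≤ (hi<n T v∈T)))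

  side-over : InnerFace G T → v ∉ T → lo T ℕ.≤ toℕ v → toℕ v ℕ.≤ hi T →
              ∃₂ λ a b → ChordOver v a b × toℕ b ∸ toℕ a ℕ.< len T
  side-over {T} {v} face v∉T lo≤v v≤hi with 0<∣p∣⇒Nonempty T (≤-trans (s≤s z≤n) (proj₁ face))
  ... | k , k∈T with greatest (λ j → (j ∈? T) ×-dec (j Fin.<? v)) | least (λ j → (j ∈? T) ×-dec (v Fin.<? j))
  ... | inj₂ none | _ = contradiction (proj₂ (member-below T k∈T v∉T lo≤v)) (none _)
  ... | inj₁ _ | inj₂ none = contradiction (proj₂ (member-above T k∈T v∉T v≤hi)) (none _)
  ... | inj₁ (a , (a∈T , a<v) , a-max) | inj₁ (b , (b∈T , v<b) , b-min) =
    a , b , (side face a∈T b∈T a<b (inj₁ gap) , a<v , v<b) , gap<len T (proj₁ face) a∈T b∈T a<b gap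
    where
    a<b = <-trans a<v v<b
    gap : ∀ j → j ∈ T → ¬ (a < j × j < b)
    gap j j∈T (a<j , j<b) with Fin.<-cmp j v
    ... | tri< j<v _ _ = <⇒≱ a<j (a-max j (j∈T , j<v))
    ... | tri≈ _ refl _ = v∉T j∈T
    ... | tri> _ _ v<j = <⇒≱ j<b (b-min j (j∈T , v<j))

  innermost<len : InnerFace G T → v ∉ T → lo T ℕ.≤ toℕ v → toℕ v ℕ.≤ hi T → innermost v ℕ.< len T
  innermost<len face v∉T lo≤v v≤hi with side-over face v∉T lo≤v v≤hi
  ... | a , b , chord , shorter = ≤-<-trans (innermost≤ chord) shorter

  ∈⇔under-innermost : InnerFace G T →
    v ∈ T ⇔ (lo T ℕ.≤ toℕ v × toℕ v ℕ.≤ hi T × len T ℕ.≤ innermost v)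
  ∈⇔under-innermost {T} {v} face = mk⇔ (λ v∈T → lo≤ T v∈T , ≤hi T v∈T , len≤innermost face v∈T) from
    where
    from : lo T ℕ.≤ toℕ v × toℕ v ℕ.≤ hi T × len T ℕ.≤ innermost v → v ∈ T
    from (lo≤v , v≤hi , len≤) with v ∈? T
    ... | yes v∈T = v∈T
    ... | no v∉T = contradiction len≤ (<⇒≱ (innermost<len face v∉T lo≤v v≤hi))


module Representation (G : OuterplanarMap) where
  open OuterplanarMap G
  open Faces G

  instance
    2^n≢0 : NonZero (2 ^ n)
    2^n≢0 = m^n≢0 2 n

  faceHeight : Subset n → ℕ
  faceHeight T = suc (code T + len T * 2 ^ n)

  rayTop : Fin n → ℕ
  rayTop v = suc (innermost v) * 2 ^ n

  faceHeight≤rayTop⇔len≤innermost : ∀ T v → faceHeight T ℕ.≤ rayTop v ⇔ len T ℕ.≤ innermost v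
  faceHeight≤rayTop⇔len≤innermost T v = mk⇔ (s≤s⁻¹ ∘ to) (from ∘ s≤s)
    where open Equivalence (m+n*k<o*k⇔n<o (len T) (suc (innermost v)) (code< T))

  faceHeight-injective : ∀ S T → faceHeight S ≡ faceHeight T → S ≡ T
  faceHeight-injective S T eq = code-injective S T (begin
    code S                          ≡⟨ [m+n*k]%k≡m (len S) (code< S) ⟨
    (code S + len S * 2 ^ n) % 2 ^ n ≡⟨ cong (_% 2 ^ n) (suc-injective eq) ⟩
    (code T + len T * 2 ^ n) % 2 ^ n ≡⟨ [m+n*k]%k≡m (len T) (code< T) ⟩
    code T                          ∎)
    where open ≡-Reasoning

  -- The outer segment runs to n + 1 so that it is nondegenerate even when n = 0.
  shape : Elem G → Shape
  shape (inj₁ v) = ray (toℚ (toℕ v)) (toℚ (rayTop v))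
  shape (inj₂ (inj₁ _)) = seg (toℚ 0) (toℚ 0) (toℚ (suc n))
  shape (inj₂ (inj₂ T)) = seg (toℚ (faceHeight T)) (toℚ (lo T)) (toℚ (hi T))

  shape-wellFormed : ∀ x → IsElem G x → WellFormed (shape x)
  shape-wellFormed (inj₁ v) _ = tt
  shape-wellFormed (inj₂ (inj₁ _)) _ = toℚ-mono-< (s≤s z≤n)
  shape-wellFormed (inj₂ (inj₂ T)) face = toℚ-mono-< (2<∣p∣⇒lo<hi T (proj₁ face))

  shapes-disjoint : ∀ x y → x ≢ y → SameKind (shape x) (shape y) → ¬ Meets down (shape x) (shape y)
  shapes-disjoint (inj₁ v) (inj₁ w) v≢w _ eq = v≢w (cong inj₁ (Fin.toℕ-injective (toℚ-injective eq)))
  shapes-disjoint (inj₂ (inj₁ _)) (inj₂ (inj₁ _)) o≢o _ _ = o≢o refl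
  shapes-disjoint (inj₂ (inj₁ _)) (inj₂ (inj₂ T)) _ _ (eq , _) with toℚ-injective eq
  ... | ()
  shapes-disjoint (inj₂ (inj₂ T)) (inj₂ (inj₁ _)) _ _ (eq , _) with toℚ-injective eq
  ... | ()
  shapes-disjoint (inj₂ (inj₂ S)) (inj₂ (inj₂ T)) S≢T _ (eq , _) =
    S≢T (cong (inj₂ ∘ inj₂) (faceHeight-injective S T (toℚ-injective eq)))
  shapes-disjoint (inj₁ _) (inj₂ (inj₁ _)) _ ()
  shapes-disjoint (inj₁ _) (inj₂ (inj₂ _)) _ ()
  shapes-disjoint (inj₂ (inj₁ _)) (inj₁ _) _ ()
  shapes-disjoint (inj₂ (inj₂ _)) (inj₁ _) _ ()

  vertex-meets-outer : ∀ v → Meets down (shape (inj₁ v)) (shape (inj₂ (inj₁ tt)))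
  vertex-meets-outer v = toℚ-mono-≤ z≤n , toℚ-mono-≤ (m<n⇒m≤1+n (Fin.toℕ<n v)) , toℚ-mono-≤ z≤n

  ∈⇔vertex-meets-face : ∀ {T v} → InnerFace G T → v ∈ T ⇔ Meets down (shape (inj₁ v)) (shape (inj₂ (inj₂ T)))
  ∈⇔vertex-meets-face {T} {v} face = mk⇔
    (λ v∈T → let lo≤v , v≤hi , len≤ = to incidence v∈T in
      toℚ-mono-≤ lo≤v , toℚ-mono-≤ v≤hi , toℚ-mono-≤ (from heights len≤))
    (λ (lo≤v , v≤hi , below) →
      from incidence (toℚ-cancel-≤ lo≤v , toℚ-cancel-≤ v≤hi , to heights (toℚ-cancel-≤ below)))
    where
    open Equivalence
    incidence = ∈⇔under-innermost {T} {v} face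
    heights = faceHeight≤rayTop⇔len≤innermost T v

  disjoint⇒⇔ : ∀ x y → ¬ Comparable G x y → ¬ Meets down (shape x) (shape y) →
               Comparable G x y ⇔ Meets down (shape x) (shape y)
  disjoint⇒⇔ _ _ incomparable disjoint = mk⇔ (⊥-elim ∘ incomparable) (⊥-elim ∘ disjoint)

  comparable⇔meets : ∀ x y → IsElem G x → IsElem G y → x ≢ y →
                     Comparable G x y ⇔ Meets down (shape x) (shape y)
  comparable⇔meets (inj₁ v) (inj₂ (inj₁ _)) _ _ _ = mk⇔ (λ _ → vertex-meets-outer v) (λ _ → inj₁ tt)
  comparable⇔meets (inj₂ (inj₁ _)) (inj₁ v) _ _ _ = mk⇔ (λ _ → vertex-meets-outer v) (λ _ → inj₂ tt)
  comparable⇔meets (inj₁ v) (inj₂ (inj₂ T)) _ face _ =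
    mk⇔ (λ { (inj₁ v∈T) → Equivalence.to (∈⇔vertex-meets-face face) v∈T ; (inj₂ ()) })
        (inj₁ ∘ Equivalence.from (∈⇔vertex-meets-face face))
  comparable⇔meets (inj₂ (inj₂ T)) (inj₁ v) face _ _ =
    mk⇔ (λ { (inj₁ ()) ; (inj₂ v∈T) → Equivalence.to (∈⇔vertex-meets-face face) v∈T })
        (inj₂ ∘ Equivalence.from (∈⇔vertex-meets-face face))
  comparable⇔meets x@(inj₁ _) y@(inj₁ _) _ _ x≢y =
    disjoint⇒⇔ x y (λ { (inj₁ ()) ; (inj₂ ()) }) (shapes-disjoint x y x≢y tt)
  comparable⇔meets x@(inj₂ (inj₁ _)) y@(inj₂ (inj₁ _)) _ _ x≢y =
    disjoint⇒⇔ x y (λ { (inj₁ ()) ; (inj₂ ()) }) (shapes-disjoint x y x≢y tt)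
  comparable⇔meets x@(inj₂ (inj₁ _)) y@(inj₂ (inj₂ _)) _ _ x≢y =
    disjoint⇒⇔ x y (λ { (inj₁ ()) ; (inj₂ ()) }) (shapes-disjoint x y x≢y tt)
  comparable⇔meets x@(inj₂ (inj₂ _)) y@(inj₂ (inj₁ _)) _ _ x≢y =
    disjoint⇒⇔ x y (λ { (inj₁ ()) ; (inj₂ ()) }) (shapes-disjoint x y x≢y tt)
  comparable⇔meets x@(inj₂ (inj₂ _)) y@(inj₂ (inj₂ _)) _ _ x≢y =
    disjoint⇒⇔ x y (λ { (inj₁ ()) ; (inj₂ ()) }) (shapes-disjoint x y x≢y tt)

proposition16 : (G : OuterplanarMap) → IsSegRay (Elem G) (IsElem G) (Comparable G)
proposition16 G = down , shape , shape-wellFormed , (λ x y _ _ → shapes-disjoint x y) , comparable⇔meets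
  where open Representation G
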